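{- Let $\mathcal{M}_1=((X_1,\mathcal{N}_1),\mathcal{I},V_1)$ and $\mathcal{M}_2=((X_2,\mathcal{N}_2),\mathcal{I},V_2)$ be neighbourhood models over the same index space $\mathcal{I}$, and let $(Z_{\mathcal{N}},Z_1,Z_2)$ be a path preserving bisimulation between $\mathcal{M}_1$ and $\mathcal{M}_2$. Let $\varphi$ be an SLCS formula such that for all $x_1\in X_1$, $x_2\in X_2$ with $x_1 Z_{\mathcal{N}} x_2$ we have $\mathcal{M}_1,x_1\models\varphi$ if and only if $\mathcal{M}_2,x_2\models\varphi$. Then for all paths $p$ on $\mathcal{M}_1$, $q$ on $\mathcal{M}_2$ and indices $n,m\in\mathcal{I}$: if $(p,n) Z_1 (q,m)$ and $\mathcal{M}_1,p,(0,n)\models\varphi$, then $\mathcal{M}_2,q,(0,m)\models\varphi$; and if $(q,m) Z_2 (p,n)$ and $\mathcal{M}_2,q,(0,m)\models\varphi$, then $\mathcal{M}_1,p,(0,n)\models\varphi$.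
   Context: A filter on a set $X$ is a set $F\subseteq\mathcal{P}(X)$ closed under non-empty (finite) intersections and supersets, with $\emptyset\notin F$. A neighbourhood space $(X,\mathcal{N})$ assigns to each $x\in X$ a filter $\mathcal{N}(x)$ on $X$ with $x\in N$ for all $N\in\mathcal{N}(x)$. Closure: $\mathcal{C}(A)=\{x\in X\mid \forall N\in\mathcal{N}(x):A\cap N\neq\emptyset\}$. A map $f$ between neighbourhood spaces is continuous if for every $x$ and every $N_2\in\mathcal{N}_2(f(x))$ we have $f^{ -1}[N_2]\in\mathcal{N}_1(x)$. Sets $U,V$ are semi-separated if $\mathcal{C}(U)\cap V=U\cap\mathcal{C}(V)=\emptyset$; a set is connected if it is not the union of two non-empty semi-separated sets. An index space $\mathcal{I}=(I,\mathcal{N}_I,\le,0)$ is a connected neighbourhood space with a linear order $\le$ having least element $0$. A path on a space $X$ is a continuous map $p:\mathcal{I}\to X$; it starts at $x$ (written $p:x\rightsquigarrow\infty$) if $p(0)=x$. A neighbourhood model $\mathcal{M}=((X,\mathcal{N}),\mathcal{I},V)$ consists of a neighbourhood space, an index space, and a valuation $V:X\to\mathcal{P}(\mathsf{P})$ for a fixed countable set $\mathsf{P}$ of atoms. SLCS formulas: $\varphi::=a\mid\top\mid\neg\varphi\mid\varphi\wedge\varphi\mid\mathcal{N}\varphi\mid\varphi\,\mathcal{R}\,\varphi\mid\varphi\,\mathcal{P}\,\varphi$ ($a\in\mathsf{P}$). Semantics: $\top$ always true; $x\models a$ iff $a\in V(x)$; Booleans as usual; $x\models\mathcal{N}\varphi$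 iff $x\in\mathcal{C}(\{y\mid y\models\varphi\})$; $x\models\varphi\,\mathcal{R}\,\psi$ iff there are $y$, a path $p$ with $p(0)=y$ and $n$ with $p(n)=x$, $y\models\psi$, and $p(i)\models\varphi$ for all $0<i\le n$; $x\models\varphi\,\mathcal{P}\,\psi$ iff there are a path $p$ with $p(0)=x$ and $n$ with $p(n)\models\psi$ and $p(i)\models\varphi$ for all $0\le i<n$. Notation: $\mathcal{M},p,(0,n)\models\varphi$ means $\mathcal{M},p(i)\models\varphi$ for all $i\in\mathcal{I}$ with $0<i<n$. Neighbourhood bisimulation conditions for a pair $x_1 Z x_2$ with $Z\subseteq X_1\times X_2$: (atomic) $V_1(x_1)=V_2(x_2)$; (forth) for every $N_2\in\mathcal{N}_2(x_2)$ there is $N_1\in\mathcal{N}_1(x_1)$ such that every $y_1\in N_1$ has some $y_2\in N_2$ with $y_1Zy_2$; (back) for every $N_1\in\mathcal{N}_1(x_1)$ there is $N_2\in\mathcal{N}_2(x_2)$ such that every $y_2\in N_2$ has some $y_1\in N_1$ with $y_1Zy_2$. Path preserving bisimulation: with $\mathcal{P}_1,\mathcal{P}_2$ the sets of all paths on $\mathcal{M}_1,\mathcal{M}_2$, a triple $(Z_{\mathcal{N}},Z_1,Z_2)$ with $\emptyset\ne Z_{\mathcal{N}}\subseteq X_1\times X_2$, $Z_1\subseteq(\mathcal{P}_1\times I)\times(\mathcal{P}_2\times I)$, $Z_2\subseteq(\mathcal{P}_2\times I)\times(\mathcal{P}_1\times I)$ such that: (1) every pair in $Z_{\mathcal{N}}$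 satisfies the neighbourhood bisimulation conditions w.r.t. $Z_{\mathcal{N}}$; (2) if $x_1Z_{\mathcal{N}}x_2$, $p$ a path with $p(0)=x_1$, $n\ne0$, then there are a path $q$ with $q(0)=x_2$ and $m$ with $p(n)Z_{\mathcal{N}}q(m)$ and $(p,n)Z_1(q,m)$; (3) if $x_1Z_{\mathcal{N}}x_2$, $p$ a path with $p(n)=x_1$, $n\ne0$, then there are a path $q$ and $m$ with $q(m)=x_2$, $p(0)Z_{\mathcal{N}}q(0)$ and $(p,n)Z_1(q,m)$; (4) if $(p,n)Z_1(q,m)$ and $0<k_q<m$, then there is $k_p$ with $0<k_p<n$ and $p(k_p)Z_{\mathcal{N}}q(k_q)$; (5) if $x_1Z_{\mathcal{N}}x_2$, $q$ a path with $q(0)=x_2$, $m\ne0$, then there are a path $p$ with $p(0)=x_1$ and $n$ with $p(n)Z_{\mathcal{N}}q(m)$ and $(q,m)Z_2(p,n)$; (6) if $x_1Z_{\mathcal{N}}x_2$, $q$ a path with $q(m)=x_2$, $m\ne0$, then there are a path $p$ and $n$ with $p(n)=x_1$, $p(0)Z_{\mathcal{N}}q(0)$ and $(q,m)Z_2(p,n)$; (7) if $(q,m)Z_2(p,n)$ and $0<k_p<n$, then there is $k_q$ with $0<k_q<m$ and $p(k_p)Z_{\mathcal{N}}q(k_q)$. -}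

module Defs where

open import Level using (Level; _⊔_) renaming (suc to lsuc; zero to lzero)
open import Data.Nat using (ℕ)
open import Data.Product using (Σ; _×_; _,_; ∃; ∃-syntax)
open import Data.Sum using (_⊎_)
open import Data.Empty using (⊥)
open import Data.Unit using (⊤)
open import Relation.Nullary using (¬_)
open import Relation.Binary.PropositionalEquality using (_≡_; _≢_)
open import Function.Bundles using (_⇔_)

Subset : Set → Set₁
Subset X = X → Set

_∈_ : {X : Set} → X → Subset X → Set
x ∈ A = A x

_⊆_ : {X : Set} → Subset X → Subset X → Set
A ⊆ B = ∀ x → A x → B x

_∩_ : {X : Set} → Subset X → Subset X → Subset X
(A ∩ B) x = A x × B x

_∪_ : {X : Set} → Subset X → Subset X → Subset X
(A ∪ B) x = A x ⊎ B x

Empty : {X : Set} → Subset X → Set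
Empty A = ∀ x → ¬ A x

NonEmpty : {X : Set} → Subset X → Set
NonEmpty {X} A = Σ X A

_≐_ : {X : Set} → Subset X → Subset X → Set
A ≐ B = A ⊆ B × B ⊆ A

preimage : {X Y : Set} → (X → Y) → Subset Y → Subset X
preimage f B x = B (f x)

record IsFilter {X : Set} (F : Subset X → Set) : Set₁ where
  field
    ∩-closed : ∀ A B → F A → F B → F (A ∩ B)
    ⊇-closed : ∀ A B → F A → A ⊆ B → F B
    no-∅     : ∀ A → F A → ¬ Empty A

record NbhdSpace : Set₁ where
  field
    X        : Set
    𝒩        : X → Subset X → Set
    isFilter : ∀ x → IsFilter (𝒩 x)
    refl∈    : ∀ x N → 𝒩 x N → x ∈ N

module _ (S : NbhdSpace) where
  open NbhdSpace S

  𝒞 : Subset X → X → Set₁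
  𝒞 A x = ∀ N → 𝒩 x N → NonEmpty (A ∩ N)

  SemiSeparated : Subset X → Subset X → Set₁
  SemiSeparated U W = (∀ x → 𝒞 U x → ¬ W x) × (∀ x → U x → ¬ 𝒞 W x)

  Connected : Subset X → Set₁
  Connected A = ¬ (Σ (Subset X) λ U → Σ (Subset X) λ W →
                     (A ≐ (U ∪ W)) × NonEmpty U × NonEmpty W × SemiSeparated U W)

Continuous : (S₁ S₂ : NbhdSpace) → (NbhdSpace.X S₁ → NbhdSpace.X S₂) → Set₁
Continuous S₁ S₂ f = ∀ x N₂ → NbhdSpace.𝒩 S₂ (f x) N₂ → NbhdSpace.𝒩 S₁ x (preimage f N₂)

record IsLinearOrder {I : Set} (_≤_ : I → I → Set) : Set where
  field
    reflexive : ∀ i → i ≤ i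
    trans     : ∀ i j k → i ≤ j → j ≤ k → i ≤ k
    antisym   : ∀ i j → i ≤ j → j ≤ i → i ≡ j
    total     : ∀ i j → (i ≤ j) ⊎ (j ≤ i)

record IndexSpace : Set₁ where
  field
    space     : NbhdSpace
  open NbhdSpace space public
  field
    connected : Connected space (λ _ → ⊤)
    _≤_       : X → X → Set
    linear    : IsLinearOrder _≤_
    𝟘         : X
    least     : ∀ i → 𝟘 ≤ i

  _<_ : X → X → Set
  i < j = (i ≤ j) × (i ≢ j)

-- Atoms: the fixed countable set P is ℕ.
Atom : Set
Atom = ℕ

record NbhdModel (𝓘 : IndexSpace) : Set₁ where
  field
    space : NbhdSpace
  open NbhdSpace space public
  field
    V : X → Subset Atom

module _ {𝓘 : IndexSpace} (M : NbhdModel 𝓘) where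
  open IndexSpace 𝓘 using (_≤_; _<_; 𝟘) renaming (X to I)
  open NbhdModel M

  record Path : Set₁ where
    constructor path
    field
      fn   : I → X
      cont : Continuous (IndexSpace.space 𝓘) (NbhdModel.space M) fn

open Path public

data Formula : Set where
  atom : Atom → Formula
  ⊤f   : Formula
  ¬f   : Formula → Formula
  _∧f_ : Formula → Formula → Formula
  𝒩f   : Formula → Formula
  _ℛ_  : Formula → Formula → Formula
  _𝒫_  : Formula → Formula → Formula

module _ {𝓘 : IndexSpace} (M : NbhdModel 𝓘) where
  open IndexSpace 𝓘 using (_≤_; _<_; 𝟘) renaming (X to I)
  open NbhdModel M

  _⊨_ : X → Formula → Set₁
  x ⊨ atom a  = Level.Lift _ (a ∈ V x)
  x ⊨ ⊤f      = Level.Lift _ ⊤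
  x ⊨ ¬f φ    = ¬ (x ⊨ φ)
  x ⊨ (φ ∧f ψ) = (x ⊨ φ) × (x ⊨ ψ)
  x ⊨ 𝒩f φ    = ∀ N → 𝒩 x N → Σ X λ y → (y ∈ N) × (y ⊨ φ)
  x ⊨ (φ ℛ ψ) = Σ X λ y → Σ (Path M) λ p → Σ I λ n →
                  (fn p 𝟘 ≡ y) × (fn p n ≡ x) × (y ⊨ ψ) ×
                  (∀ i → 𝟘 < i → i ≤ n → fn p i ⊨ φ)
  x ⊨ (φ 𝒫 ψ) = Σ (Path M) λ p → Σ I λ n →
                  (fn p 𝟘 ≡ x) × (fn p n ⊨ ψ) ×
                  (∀ i → 𝟘 ≤ i → i < n → fn p i ⊨ φ)

  -- M, p, (0,n) ⊨ φ : p(i) ⊨ φ for all i with 0 < i < n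
  HoldsOpen : Path M → I → Formula → Set₁
  HoldsOpen p n φ = ∀ i → 𝟘 < i → i < n → fn p i ⊨ φ

module _ {𝓘 : IndexSpace} (M₁ M₂ : NbhdModel 𝓘) where
  private
    module M₁ = NbhdModel M₁
    module M₂ = NbhdModel M₂
  open IndexSpace 𝓘 using (_<_; 𝟘) renaming (X to I)

  record NbhdBisimAt (Z : M₁.X → M₂.X → Set) (x₁ : M₁.X) (x₂ : M₂.X) : Set₁ where
    field
      atomic : ∀ a → (a ∈ M₁.V x₁) ⇔ (a ∈ M₂.V x₂)
      forth  : ∀ N₂ → M₂.𝒩 x₂ N₂ → Σ (Subset M₁.X) λ N₁ → M₁.𝒩 x₁ N₁ ×
                 (∀ y₁ → y₁ ∈ N₁ → Σ M₂.X λ y₂ → (y₂ ∈ N₂) × Z y₁ y₂)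
      back   : ∀ N₁ → M₁.𝒩 x₁ N₁ → Σ (Subset M₂.X) λ N₂ → M₂.𝒩 x₂ N₂ ×
                 (∀ y₂ → y₂ ∈ N₂ → Σ M₁.X λ y₁ → (y₁ ∈ N₁) × Z y₁ y₂)

  record IsPathPresBisim (Z𝒩 : M₁.X → M₂.X → Set)
                         (Z₁ : Path M₁ × I → Path M₂ × I → Set)
                         (Z₂ : Path M₂ × I → Path M₁ × I → Set) : Set₁ where
    field
      nonempty : Σ M₁.X λ x₁ → Σ M₂.X λ x₂ → Z𝒩 x₁ x₂
      cond1 : ∀ x₁ x₂ → Z𝒩 x₁ x₂ → NbhdBisimAt Z𝒩 x₁ x₂
      cond2 : ∀ x₁ x₂ → Z𝒩 x₁ x₂ → ∀ (p : Path M₁) n → fn p 𝟘 ≡ x₁ → n ≢ 𝟘 →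
                Σ (Path M₂) λ q → Σ I λ m → (fn q 𝟘 ≡ x₂) ×
                  Z𝒩 (fn p n) (fn q m) × Z₁ (p , n) (q , m)
      cond3 : ∀ x₁ x₂ → Z𝒩 x₁ x₂ → ∀ (p : Path M₁) n → fn p n ≡ x₁ → n ≢ 𝟘 →
                Σ (Path M₂) λ q → Σ I λ m → (fn q m ≡ x₂) ×
                  Z𝒩 (fn p 𝟘) (fn q 𝟘) × Z₁ (p , n) (q , m)
      cond4 : ∀ p n q m → Z₁ (p , n) (q , m) → ∀ kq → 𝟘 < kq → kq < m →
                Σ I λ kp → 𝟘 < kp × kp < n × Z𝒩 (fn p kp) (fn q kq)
      cond5 : ∀ x₁ x₂ → Z𝒩 x₁ x₂ → ∀ (q : Path M₂) m → fn q 𝟘 ≡ x₂ → m ≢ 𝟘 →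
                Σ (Path M₁) λ p → Σ I λ n → (fn p 𝟘 ≡ x₁) ×
                  Z𝒩 (fn p n) (fn q m) × Z₂ (q , m) (p , n)
      cond6 : ∀ x₁ x₂ → Z𝒩 x₁ x₂ → ∀ (q : Path M₂) m → fn q m ≡ x₂ → m ≢ 𝟘 →
                Σ (Path M₁) λ p → Σ I λ n → (fn p n ≡ x₁) ×
                  Z𝒩 (fn p 𝟘) (fn q 𝟘) × Z₂ (q , m) (p , n)
      cond7 : ∀ q m p n → Z₂ (q , m) (p , n) → ∀ kp → 𝟘 < kp → kp < n →
                Σ I λ kq → 𝟘 < kq × kq < m × Z𝒩 (fn p kp) (fn q kq)

module Submission where

-- The argument only uses conditions (4) and (7) of the bisimulation: every
-- index strictly inside the target interval is matched by some index strictly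
-- inside the source interval whose point is Z𝒩-related to the target point.

open import Defs
open import Data.Product using (Σ; _×_; _,_)
open import Function using (flip)
open import Function.Bundles using (_⇔_; Equivalence)

module _ {𝓘 : IndexSpace} (A B : NbhdModel 𝓘) where
  open IndexSpace 𝓘 using (_<_; 𝟘) renaming (X to I)
  private
    module A = NbhdModel A
    module B = NbhdModel B

  IntervalCovered : (R : A.X → B.X → Set) → Path A → I → Path B → I → Set
  IntervalCovered R p n q m =
    ∀ k → 𝟘 < k → k < m → Σ I λ k′ → 𝟘 < k′ × k′ < n × R (fn p k′) (fn q k)

  holdsOpen-transfer : (R : A.X → B.X → Set) (φ : Formula) →
    (∀ x y → R x y → _⊨_ A x φ → _⊨_ B y φ) →
    ∀ p n q m → IntervalCovered R p n q m →
    HoldsOpen A p n φ → HoldsOpen B q m φ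
  holdsOpen-transfer R φ preserve p n q m covered holdsP k 0<k k<m =
    let (k′ , 0<k′ , k′<n , related) = covered k 0<k k<m
    in preserve (fn p k′) (fn q k) related (holdsP k′ 0<k′ k′<n)

lemma16 : (𝓘 : IndexSpace) (M₁ M₂ : NbhdModel 𝓘)
    (Z𝒩 : NbhdModel.X M₁ → NbhdModel.X M₂ → Set)
    (Z₁ : Path M₁ × IndexSpace.X 𝓘 → Path M₂ × IndexSpace.X 𝓘 → Set)
    (Z₂ : Path M₂ × IndexSpace.X 𝓘 → Path M₁ × IndexSpace.X 𝓘 → Set) →
    IsPathPresBisim M₁ M₂ Z𝒩 Z₁ Z₂ →
    (φ : Formula) →
    (∀ x₁ x₂ → Z𝒩 x₁ x₂ → (_⊨_ M₁ x₁ φ) ⇔ (_⊨_ M₂ x₂ φ)) →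
    (∀ (p : Path M₁) (q : Path M₂) (n m : IndexSpace.X 𝓘) →
    (Z₁ (p , n) (q , m) → HoldsOpen M₁ p n φ → HoldsOpen M₂ q m φ) ×
    (Z₂ (q , m) (p , n) → HoldsOpen M₂ q m φ → HoldsOpen M₁ p n φ))
lemma16 𝓘 M₁ M₂ Z𝒩 Z₁ Z₂ bisim φ invariant p q n m =
    (λ z₁ → holdsOpen-transfer M₁ M₂ Z𝒩 φ forward p n q m (cond4 p n q m z₁))
  , (λ z₂ → holdsOpen-transfer M₂ M₁ (flip Z𝒩) φ backward q m p n (cond7 q m p n z₂))
  where
    open IsPathPresBisim bisim using (cond4; cond7)

    forward : ∀ x₁ x₂ → Z𝒩 x₁ x₂ → _⊨_ M₁ x₁ φ → _⊨_ M₂ x₂ φ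
    forward x₁ x₂ z = Equivalence.to (invariant x₁ x₂ z)

    backward : ∀ x₂ x₁ → Z𝒩 x₁ x₂ → _⊨_ M₂ x₂ φ → _⊨_ M₁ x₁ φ
    backward x₂ x₁ z = Equivalence.from (invariant x₁ x₂ z)
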